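{- There are absolute constants $c,c'>0$ such that the following holds for every $\beta\geq1$ and $\Delta\geq1$. Let $G_S=(S,N,E_S)$ be a bipartite graph with $|N|\geq\beta|S|$, maximum degree $\Delta$, and no isolated vertices, and let $\delta_N=\frac{1}{|N|}\sum_{u\in N}\deg(u,S)$. Then there exists $S^*\subseteq S$ with $$|\Gamma^1_S(S^*)|\;\geq\; c\,\frac{|N|}{\log(2\delta_N)}\;\geq\; c\,\frac{\beta}{\log(2\delta_N)}\,|S|.$$ Consequently, every $(\alpha,\beta)$-expander with maximum degree $\Delta$ (and $\beta\ge1$) has wireless expansion $\beta_w\geq c'\beta/\log(2\Delta/\beta)$.
   Context: Logarithms are base 2. $\deg(u,S)$ is the number of neighbors of $u$ in $S$. For $S'\subseteq S$, $\Gamma^1_S(S')$ is the set of vertices outside $S$ (here: in $N$) with exactly one neighbor in $S'$. A graph $G=(V,E)$ on $n$ vertices is an $(\alpha,\beta)$-expander if $|\Gamma(X)\setminus X|\geq\beta|X|$ for all $X\subseteq V$ with $|X|\le\alpha n$, where $\Gamma(X)$ is the set of neighbors of $X$. Its wireless expansion is $\beta_w=\min_{X\subseteq V,|X|\leq\alpha n}\max_{X'\subseteq X}|\Gamma^1_X(X')|/|X|$. (The bipartite graph $G_S$ models the edges between a set $S$ with $|S|\le\alpha n$ and $N=\Gamma(S)\setminus S$ in such an expander.)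
   Formalization: The parameters α and β (with β ≥ 1) range over the rationals, and the absolute constants c and c' are taken rational. -}

module Defs where

open import Data.Nat using (ℕ; _+_; _*_; _^_; _≤_; _≡ᵇ_; _≤ᵇ_)
open import Data.Bool using (Bool; true; false; if_then_else_; _∧_; not)
open import Data.Fin using (Fin)
open import Data.Fin.Subset using (Subset; ∣_∣)
open import Relation.Binary.PropositionalEquality using (_≡_)
open import Data.Vec using (lookup)
open import Data.List using (allFin; map)
open import Data.Nat.ListAction using (sum)
open import Data.Product using (_×_)

count : (n : ℕ) → (Fin n → Bool) → ℕ
count n p = sum (map (λ i → if p i then 1 else 0) (allFin n))

-- Bipartite graph G_S = (S, N, E_S) with S = Fin s, N = Fin m.
-- adj v u = true iff {v,u} ∈ E_S  (v ∈ S, u ∈ N).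

record BipGraph (s m : ℕ) : Set where
  field
    adj : Fin s → Fin m → Bool

module _ {s m : ℕ} (G : BipGraph s m) where
  open BipGraph G

  degS : Fin s → ℕ
  degS v = count m (adj v)

  degN : Fin m → ℕ
  degN u = count s (λ v → adj v u)

  -- |E_S| = Σ_{u ∈ N} deg(u,S)   (so δ_N = edgesN / m)
  edgesN : ℕ
  edgesN = sum (map degN (allFin m))

  MaxDegBip : ℕ → Set
  MaxDegBip Δ = (∀ v → degS v ≤ Δ) × (∀ u → degN u ≤ Δ)

  NoIsolated : Set
  NoIsolated = (∀ v → 1 ≤ degS v) × (∀ u → 1 ≤ degN u)

  Γ¹size : Subset s → ℕ
  Γ¹size S' = count m (λ u → count s (λ v → lookup S' v ∧ adj v u) ≡ᵇ 1)

record Graph (n : ℕ) : Set where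
  field
    adj       : Fin n → Fin n → Bool
    adj-sym   : ∀ x y → adj x y ≡ adj y x
    adj-irrefl : ∀ x → adj x x ≡ false

module _ {n : ℕ} (G : Graph n) where
  open Graph G

  deg : Fin n → ℕ
  deg x = count n (adj x)

  MaxDeg : ℕ → Set
  MaxDeg Δ = ∀ x → deg x ≤ Δ

  boundary : Subset n → ℕ
  boundary X = count n (λ u → not (lookup X u) ∧ (1 ≤ᵇ count n (λ v → lookup X v ∧ adj v u)))

  Γ¹ : Subset n → Subset n → ℕ
  Γ¹ X X' = count n (λ u → not (lookup X u) ∧ (count n (λ v → lookup X' v ∧ adj v u) ≡ᵇ 1))

  -- (α,β)-expander with α = αn/αd and β = βn/βd (rationals):
  -- |Γ(X) \ X| ≥ β|X| for all X with |X| ≤ α n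
  IsExpander : (αn αd βn βd : ℕ) → Set
  IsExpander αn αd βn βd =
    ∀ (X : Subset n) → αd * ∣ X ∣ ≤ αn * n → βn * ∣ X ∣ ≤ βd * boundary X

-- Let G_S = (S, N, E) be bipartite and call the
-- non-isolated vertices of N active.  Choose L with |E| ≤ 2^L |active| ≤ 2|E|,
-- so 2^L ≤ 2δ_N.  By Markov's inequality at most half of the active vertices
-- have degree ≥ 2^(L+1); the others fall into the dyadic classes
-- [2^j, 2^(j+1)), j ≤ L, and the largest class holds a 1/(2(L+1)) fraction.
-- Choosing every vertex of S independently with probability 1/(4·2^j), a
-- vertex of class j has exactly one chosen neighbour with probability ≥ 1/8,
-- so some S* has |active| ≤ 32 L |Γ¹(S*)|  (`wireless-bipartite`).
-- Probabilities are replaced by exact counting: `wsum` weighs a subset by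
-- e^(number of elements left out), and `wsum-argmax` is the probabilistic method.
-- Both claims follow by clearing the logarithm (`exp-form`); for an expander
-- the lemma is applied to the bipartite graph between X and Γ(X) \ X.

module Submission where

open import Defs
open import Data.Nat using (ℕ; zero; suc; _+_; _*_; _^_; _≤_; _<_; z≤n; s≤s; _≡ᵇ_; _≤ᵇ_; _<ᵇ_; _∸_; >-nonZero)
open import Data.Nat.Properties
open import Data.Nat.Tactic.RingSolver using (solve-∀)
open import Data.Nat.ListAction as List using ()
open import Data.Bool using (Bool; true; false; if_then_else_; _∧_; not)
open import Data.Bool.Properties using (∧-zeroʳ; ∧-identityʳ; T-≡)
open import Data.List using (map; allFin; tabulate)
open import Data.List.Properties using (map-tabulate)
open import Data.Fin using (Fin; zero; suc; toℕ; fromℕ<)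
open import Data.Fin.Properties using (toℕ-fromℕ<)
open import Data.Fin.Subset using (Subset; ∣_∣; _⊆_; Nonempty; _∩_) renaming (⊥ to ∅)
open import Data.Fin.Subset.Properties using (x∈p∩q⁻)
open import Data.Vec using ([]; _∷_; lookup)
open import Data.Vec.Properties using (lookup-zipWith; []=⇒lookup)
open import Data.Product using (Σ; _×_; _,_; ∃-syntax; proj₁; proj₂)
open import Data.Empty using (⊥-elim)
open import Function using (id; _∘_)
open import Function.Bundles using (module Equivalence)
open import Relation.Binary.PropositionalEquality
open import Relation.Nullary using (Dec; yes; no)
open import Algebra.Properties.Semiring.Sum +-*-semiring
  using (sum-syntax; ∑-distrib-+; ∑-comm; *-distribˡ-sum; sum-cong-≗; sum-replicate-zero)
open import Algebra.Properties.CommutativeSemigroup *-commutativeSemigroup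
  using () renaming (x∙yz≈y∙xz to x*[y*z]≡y*[x*z]; x∙yz≈y∙zx to x*[y*z]≡y*[z*x]; x∙yz≈yx∙z to x*[y*z]≡y*x*z)

bit : Bool → ℕ
bit b = if b then 1 else 0

∑-mono : ∀ {n} {f g : Fin n → ℕ} → (∀ i → f i ≤ g i) → ∑[ i < n ] f i ≤ ∑[ i < n ] g i
∑-mono {zero} le = z≤n
∑-mono {suc n} le = +-mono-≤ (le zero) (∑-mono (le ∘ suc))

∑-term : ∀ {n} (f : Fin n → ℕ) (i : Fin n) → f i ≤ ∑[ j < n ] f j
∑-term f zero = m≤m+n (f zero) _
∑-term f (suc i) = m≤n⇒m≤o+n (f zero) (∑-term (f ∘ suc) i)

∑-average : ∀ {n} (f : Fin (suc n) → ℕ) → ∃[ j ] (∑[ i < suc n ] f i ≤ suc n * f j)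
∑-average {zero} f = zero , ≤-refl
∑-average {suc n} f with ∑-average (f ∘ suc)
... | j , rest≤ with f zero ≤? f (suc j)
...   | yes f0≤fj = suc j , +-mono-≤ f0≤fj rest≤
...   | no f0≰fj = zero , +-monoʳ-≤ (f zero) (≤-trans rest≤ (*-monoʳ-≤ (suc n) (≰⇒≥ f0≰fj)))

listSum≡∑ : ∀ n (f : Fin n → ℕ) → List.sum (map f (allFin n)) ≡ ∑[ i < n ] f i
listSum≡∑ n f = trans (cong List.sum (map-tabulate id f)) (sumTabulate n f)
  where
  sumTabulate : ∀ n (f : Fin n → ℕ) → List.sum (tabulate f) ≡ ∑[ i < n ] f i
  sumTabulate zero f = refl
  sumTabulate (suc n) f = cong (f zero +_) (sumTabulate n (f ∘ suc))

count≡∑ : ∀ n (p : Fin n → Bool) → count n p ≡ ∑[ i < n ] bit (p i)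
count≡∑ n p = listSum≡∑ n (bit ∘ p)

count-cong : ∀ n {p q : Fin n → Bool} → (∀ i → p i ≡ q i) → count n p ≡ count n q
count-cong n {p} {q} p≗q = trans (count≡∑ n p) (trans (sum-cong-≗ (cong bit ∘ p≗q)) (sym (count≡∑ n q)))

count-none : ∀ n {p : Fin n → Bool} → (∀ i → p i ≡ false) → count n p ≡ 0
count-none n none = trans (count-cong n none) (trans (count≡∑ n (λ _ → false)) (sum-replicate-zero n))

∑-ones : ∀ m → ∑[ u < m ] 1 ≡ m
∑-ones zero = refl
∑-ones (suc m) = cong suc (∑-ones m)

-- Weighted sum over all subsets S of `Fin s` in which every element left out
-- of S contributes a factor e:  wsum s e g = Σ_S e^(s - |S|) g(S).  Divided by
-- (1+e)^s it is the expectation of g(S) when each element is put into S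
-- independently with probability 1/(1+e); this is the probability space of
-- the random construction, handled by exact counting.
wsum : (s e : ℕ) → (Subset s → ℕ) → ℕ
wsum zero e g = g []
wsum (suc s) e g = wsum s e (λ S → g (true ∷ S)) + e * wsum s e (λ S → g (false ∷ S))

wsum-cong : ∀ s e {g h : Subset s → ℕ} → (∀ S → g S ≡ h S) → wsum s e g ≡ wsum s e h
wsum-cong zero e g≡h = g≡h []
wsum-cong (suc s) e g≡h =
  cong₂ (λ a b → a + e * b) (wsum-cong s e (λ S → g≡h (true ∷ S))) (wsum-cong s e (λ S → g≡h (false ∷ S)))

wsum-zero : ∀ s e → wsum s e (λ _ → 0) ≡ 0
wsum-zero zero e = refl
wsum-zero (suc s) e rewrite wsum-zero s e | *-zeroʳ e = refl

wsum-∑ : ∀ s e {m} (h : Subset s → Fin m → ℕ) →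
  wsum s e (λ S → ∑[ j < m ] h S j) ≡ ∑[ j < m ] wsum s e (λ S → h S j)
wsum-∑ zero e h = refl
wsum-∑ (suc s) e {m} h = begin
  wsum s e (λ S → ∑[ j < m ] h (true ∷ S) j) + e * wsum s e (λ S → ∑[ j < m ] h (false ∷ S) j)
    ≡⟨ cong₂ (λ a b → a + e * b) (wsum-∑ s e (h ∘ (true ∷_))) (wsum-∑ s e (h ∘ (false ∷_))) ⟩
  ∑[ j < m ] inc j + e * ∑[ j < m ] exc j
    ≡⟨ cong (∑[ j < m ] inc j +_) (*-distribˡ-sum e exc) ⟩
  ∑[ j < m ] inc j + ∑[ j < m ] (e * exc j)
    ≡⟨ sym (∑-distrib-+ inc (λ j → e * exc j)) ⟩
  ∑[ j < m ] (inc j + e * exc j) ∎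
  where
  open ≡-Reasoning
  inc exc : Fin m → ℕ
  inc j = wsum s e (λ S → h (true ∷ S) j)
  exc j = wsum s e (λ S → h (false ∷ S) j)

wsum-split-≤ : ∀ s e (g : Subset (suc s) → ℕ) b →
  wsum s e (λ S → g (true ∷ S)) ≤ suc e ^ s * b → wsum s e (λ S → g (false ∷ S)) ≤ suc e ^ s * b →
  wsum (suc s) e g ≤ suc e ^ suc s * b
wsum-split-≤ s e g b inc≤ exc≤ =
  ≤-trans (+-mono-≤ inc≤ (*-monoʳ-≤ e exc≤)) (≤-reflexive (sym (*-assoc (suc e) (suc e ^ s) b)))

wsum-argmax : ∀ s e (g : Subset s → ℕ) → ∃[ S ] (wsum s e g ≤ suc e ^ s * g S)
wsum-argmax zero e g = [] , ≤-reflexive (sym (+-identityʳ (g [])))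
wsum-argmax (suc s) e g
  with wsum-argmax s e (λ S → g (true ∷ S)) | wsum-argmax s e (λ S → g (false ∷ S))
... | S₁ , inc≤ | S₀ , exc≤ with g (true ∷ S₁) ≤? g (false ∷ S₀)
...   | yes g₁≤g₀ = false ∷ S₀ , wsum-split-≤ s e g _ (≤-trans inc≤ (*-monoʳ-≤ (suc e ^ s) g₁≤g₀)) exc≤
...   | no g₁≰g₀ = true ∷ S₁ , wsum-split-≤ s e g _ inc≤ (≤-trans exc≤ (*-monoʳ-≤ (suc e ^ s) (≰⇒≥ g₁≰g₀)))

size : ∀ {s} → (Fin s → Bool) → ℕ
size {s} nb = ∑[ v < s ] bit (nb v)

-- The number of elements of S lying in the set with indicator nb; for a
-- vertex u of N with neighbourhood indicator nb it is |Γ(u) ∩ S|.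
hits : ∀ {s} → (Fin s → Bool) → Subset s → ℕ
hits {s} nb S = ∑[ v < s ] bit (lookup S v ∧ nb v)

*-pow-pred : ∀ e k → e * (k * e ^ (k ∸ 1)) ≡ k * e ^ k
*-pow-pred e zero = *-zeroʳ e
*-pow-pred e (suc k) = x*[y*z]≡y*[x*z] e (suc k) (e ^ k)

-- An element outside nb multiplies every weight by 1 + e, whether or not it is chosen.
weight-extend : ∀ e {a} b d → a ≡ b * d → a + e * a ≡ b * (suc e * d)
weight-extend e b d refl = solve-extend e b d
  where
  solve-extend : ∀ e b d → b * d + e * (b * d) ≡ b * ((1 + e) * d)
  solve-extend = solve-∀

hit-weights : ∀ s e (nb : Fin s → Bool) →
  (wsum s e (λ S → bit (hits nb S ≡ᵇ 0)) ≡ e ^ size nb * suc e ^ size (not ∘ nb)) ×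
  (wsum s e (λ S → bit (hits nb S ≡ᵇ 1)) ≡ size nb * e ^ (size nb ∸ 1) * suc e ^ size (not ∘ nb))
hit-weights zero e nb = refl , refl
hit-weights (suc s) e nb with hit-weights s e (nb ∘ suc)
... | none , one with nb zero
...   | true = missOne , hitOne
  where
  open ≡-Reasoning
  k z : ℕ
  k = size (nb ∘ suc)
  z = size (not ∘ nb ∘ suc)
  missOne : wsum s e (λ _ → 0) + e * wsum s e (λ S → bit (hits (nb ∘ suc) S ≡ᵇ 0)) ≡ e * e ^ k * suc e ^ z
  missOne = begin
    wsum s e (λ _ → 0) + e * wsum s e (λ S → bit (hits (nb ∘ suc) S ≡ᵇ 0))
      ≡⟨ cong₂ (λ a b → a + e * b) (wsum-zero s e) none ⟩
    e * (e ^ k * suc e ^ z) ≡⟨ sym (*-assoc e (e ^ k) _) ⟩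
    e * e ^ k * suc e ^ z ∎
  hitOne : wsum s e (λ S → bit (hits (nb ∘ suc) S ≡ᵇ 0)) + e * wsum s e (λ S → bit (hits (nb ∘ suc) S ≡ᵇ 1))
           ≡ suc k * e ^ k * suc e ^ z
  hitOne = begin
    wsum s e (λ S → bit (hits (nb ∘ suc) S ≡ᵇ 0)) + e * wsum s e (λ S → bit (hits (nb ∘ suc) S ≡ᵇ 1))
      ≡⟨ cong₂ (λ a b → a + e * b) none one ⟩
    e ^ k * suc e ^ z + e * (k * e ^ (k ∸ 1) * suc e ^ z)
      ≡⟨ cong (e ^ k * suc e ^ z +_) (sym (*-assoc e _ (suc e ^ z))) ⟩
    e ^ k * suc e ^ z + e * (k * e ^ (k ∸ 1)) * suc e ^ z
      ≡⟨ cong (λ x → e ^ k * suc e ^ z + x * suc e ^ z) (*-pow-pred e k) ⟩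
    e ^ k * suc e ^ z + k * e ^ k * suc e ^ z
      ≡⟨ sym (*-distribʳ-+ (suc e ^ z) (e ^ k) (k * e ^ k)) ⟩
    suc k * e ^ k * suc e ^ z ∎
...   | false = weight-extend e (e ^ k) (suc e ^ z) none , weight-extend e (k * e ^ (k ∸ 1)) (suc e ^ z) one
  where
  k z : ℕ
  k = size (nb ∘ suc)
  z = size (not ∘ nb ∘ suc)

size-split : ∀ {s} (nb : Fin s → Bool) → size nb + size (not ∘ nb) ≡ s
size-split {zero} nb = refl
size-split {suc s} nb with nb zero
... | true = cong suc (size-split (nb ∘ suc))
... | false = trans (+-suc (size (nb ∘ suc)) _) (cong suc (size-split (nb ∘ suc)))

-- (1+e)^(t+1) − e^(t+1) ≤ (t+1)(1+e)^t  (the mean value bound for x ↦ x^(t+1)).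
pow-succ-gap : ∀ e t → suc e ^ suc t ≤ e ^ suc t + suc t * suc e ^ t
pow-succ-gap e zero = ≤-reflexive (base e)
  where
  base : ∀ e → (1 + e) * 1 ≡ e * 1 + 1 * 1
  base = solve-∀
pow-succ-gap e (suc t) = begin
  P + e * P                             ≤⟨ +-monoʳ-≤ P (*-monoʳ-≤ e (pow-succ-gap e t)) ⟩
  P + e * (e ^ suc t + suc t * Q)        ≡⟨ regroup P e (e ^ suc t) t Q ⟩
  e * e ^ suc t + (P + suc t * (e * Q))  ≤⟨ +-monoʳ-≤ (e * e ^ suc t) (+-monoʳ-≤ P (*-monoʳ-≤ (suc t) (m≤n+m (e * Q) Q))) ⟩
  e * e ^ suc t + (P + suc t * P)        ∎
  where
  open ≤-Reasoning
  P Q : ℕ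
  P = suc e ^ suc t
  Q = suc e ^ t
  regroup : ∀ P e a t Q → P + e * (a + (1 + t) * Q) ≡ e * a + (P + (1 + t) * (e * Q))
  regroup = solve-∀

-- If 2t ≤ 1 + e then (1 + 1/e)^t ≤ 2, i.e. (1+e)^t ≤ 2 e^t.
pow-≤-twice : ∀ e t → 2 * t ≤ suc e → suc e ^ t ≤ 2 * e ^ t
pow-≤-twice e zero _ = s≤s z≤n
pow-≤-twice e (suc t) 2t≤1+e = +-cancelʳ-≤ P P (2 * e ^ suc t) (begin
  P + P                                     ≡⟨ cong (P +_) (sym (+-identityʳ P)) ⟩
  2 * P                                     ≤⟨ *-monoʳ-≤ 2 (pow-succ-gap e t) ⟩
  2 * (e ^ suc t + suc t * Q)               ≡⟨ regroup (e ^ suc t) t Q ⟩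
  2 * e ^ suc t + 2 * suc t * Q             ≤⟨ +-monoʳ-≤ (2 * e ^ suc t) (*-monoˡ-≤ Q 2t≤1+e) ⟩
  2 * e ^ suc t + P                         ∎)
  where
  open ≤-Reasoning
  P Q : ℕ
  P = suc e ^ suc t
  Q = suc e ^ t
  regroup : ∀ a t Q → 2 * (a + (1 + t) * Q) ≡ 2 * a + 2 * (1 + t) * Q
  regroup = solve-∀

-- For a vertex of degree k = t + 1 and selection probability 1/(1+e) with
-- k ≤ 1 + e ≤ 4k (roughly), exactly one neighbour is chosen with
-- probability at least 1/8:  (1+e)^k ≤ 8 k e^(k-1).
exactly-one-bound : ∀ e t → suc e ≤ 4 * suc t → 2 * t ≤ suc e → suc e ^ suc t ≤ 8 * (suc t * e ^ t)
exactly-one-bound e t 1+e≤4k 2t≤1+e = begin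
  suc e * suc e ^ t       ≤⟨ *-mono-≤ 1+e≤4k (pow-≤-twice e t 2t≤1+e) ⟩
  4 * suc t * (2 * e ^ t) ≡⟨ regroup (suc t) (e ^ t) ⟩
  8 * (suc t * e ^ t)     ∎
  where
  open ≤-Reasoning
  regroup : ∀ k x → 4 * k * (2 * x) ≡ 8 * (k * x)
  regroup = solve-∀

exactly-one-likely : ∀ s e (nb : Fin s → Bool) t → size nb ≡ suc t →
  suc e ≤ 4 * suc t → 2 * t ≤ suc e →
  suc e ^ s ≤ 8 * wsum s e (λ S → bit (hits nb S ≡ᵇ 1))
exactly-one-likely s e nb t size≡k 1+e≤4k 2t≤1+e = begin
  suc e ^ s                                ≡⟨ cong (suc e ^_) (sym (size-split nb)) ⟩
  suc e ^ (size nb + z)                    ≡⟨ ^-distribˡ-+-* (suc e) (size nb) z ⟩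
  suc e ^ size nb * suc e ^ z              ≡⟨ cong (λ k → suc e ^ k * suc e ^ z) size≡k ⟩
  suc e ^ suc t * suc e ^ z                ≤⟨ *-monoˡ-≤ (suc e ^ z) (exactly-one-bound e t 1+e≤4k 2t≤1+e) ⟩
  8 * (suc t * e ^ t) * suc e ^ z          ≡⟨ *-assoc 8 (suc t * e ^ t) (suc e ^ z) ⟩
  8 * (suc t * e ^ t * suc e ^ z)          ≡⟨ cong (λ k → 8 * (k * e ^ (k ∸ 1) * suc e ^ z)) (sym size≡k) ⟩
  8 * (size nb * e ^ (size nb ∸ 1) * suc e ^ z) ≡⟨ cong (8 *_) (sym (proj₂ (hit-weights s e nb))) ⟩
  8 * wsum s e (λ S → bit (hits nb S ≡ᵇ 1)) ∎
  where
  open ≤-Reasoning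
  z : ℕ
  z = size (not ∘ nb)

degree-class-likely : ∀ s e d (nb : Fin s → Bool) → suc e ≡ 4 * d → d ≤ size nb → size nb < 2 * d →
  suc e ^ s ≤ 8 * wsum s e (λ S → bit (hits nb S ≡ᵇ 1))
degree-class-likely s e d nb 1+e≡4d d≤k k<2d with size nb in size≡k
... | zero with z≤n ← d≤k with () ← 1+e≡4d
... | suc t = exactly-one-likely s e nb t size≡k 1+e≤4k 2t≤1+e
  where
  1+e≤4k : suc e ≤ 4 * suc t
  1+e≤4k = subst (_≤ 4 * suc t) (sym 1+e≡4d) (*-monoʳ-≤ 4 d≤k)
  2t≤1+e : 2 * t ≤ suc e
  2t≤1+e = begin
    2 * t         ≤⟨ *-monoʳ-≤ 2 (≤-trans (m≤n+m t 2) k<2d) ⟩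
    2 * (2 * d)   ≡⟨ sym (*-assoc 2 2 d) ⟩
    4 * d         ≡⟨ sym 1+e≡4d ⟩
    suc e         ∎
    where open ≤-Reasoning

nbhd : ∀ {s m} → BipGraph s m → Fin m → Fin s → Bool
nbhd G u v = BipGraph.adj G v u

degN≡size : ∀ {s m} (G : BipGraph s m) u → degN G u ≡ size (nbhd G u)
degN≡size {s} G u = count≡∑ s (nbhd G u)

Γ¹size≡∑ : ∀ {s m} (G : BipGraph s m) S → Γ¹size G S ≡ ∑[ u < m ] bit (hits (nbhd G u) S ≡ᵇ 1)
Γ¹size≡∑ {s} {m} G S =
  trans (count≡∑ m _) (sum-cong-≗ (λ u → cong (λ c → bit (c ≡ᵇ 1)) (count≡∑ s (λ v → lookup S v ∧ nbhd G u v))))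

marked-covered : ∀ {s m} (G : BipGraph s m) e c (marked : Fin m → Bool) →
  (∀ u → marked u ≡ true → suc e ^ s ≤ c * wsum s e (λ S → bit (hits (nbhd G u) S ≡ᵇ 1))) →
  ∃[ S ] (count m marked ≤ c * Γ¹size G S)
marked-covered {s} {m} G e c marked likely =
  S* , *-cancelˡ-≤ (suc e ^ s) {{m^n≢0 (suc e) s}} (begin
    suc e ^ s * count m marked                ≡⟨ cong (suc e ^ s *_) (count≡∑ m marked) ⟩
    suc e ^ s * ∑[ u < m ] bit (marked u)     ≡⟨ *-distribˡ-sum (suc e ^ s) (bit ∘ marked) ⟩
    ∑[ u < m ] (suc e ^ s * bit (marked u))   ≤⟨ ∑-mono pointwise ⟩
    ∑[ u < m ] (c * wsum s e (λ S → hit u S)) ≡⟨ sym (*-distribˡ-sum c (λ u → wsum s e (λ S → hit u S))) ⟩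
    c * ∑[ u < m ] wsum s e (λ S → hit u S)   ≡⟨ cong (c *_) (sym (wsum-∑ s e (λ S u → hit u S))) ⟩
    c * wsum s e covered                      ≤⟨ *-monoʳ-≤ c S*-good ⟩
    c * (suc e ^ s * covered S*)              ≤⟨ *-monoʳ-≤ c (*-monoʳ-≤ (suc e ^ s) covered≤Γ¹) ⟩
    c * (suc e ^ s * Γ¹size G S*)             ≡⟨ x*[y*z]≡y*[x*z] c (suc e ^ s) _ ⟩
    suc e ^ s * (c * Γ¹size G S*)             ∎)
  where
  open ≤-Reasoning
  hit : Fin m → Subset s → ℕ
  hit u S = bit (marked u) * bit (hits (nbhd G u) S ≡ᵇ 1)
  covered : Subset s → ℕ
  covered S = ∑[ u < m ] hit u S
  S* : Subset s
  S* = proj₁ (wsum-argmax s e covered)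
  S*-good : wsum s e covered ≤ suc e ^ s * covered S*
  S*-good = proj₂ (wsum-argmax s e covered)
  pointwise : ∀ u → suc e ^ s * bit (marked u) ≤ c * wsum s e (λ S → hit u S)
  pointwise u with marked u in marked≡
  ... | false = ≤-trans (≤-reflexive (*-zeroʳ (suc e ^ s))) z≤n
  ... | true = ≤-trans (≤-reflexive (*-identityʳ (suc e ^ s)))
                 (≤-trans (likely u marked≡) (≤-reflexive (cong (c *_) (wsum-cong s e (λ S → sym (+-identityʳ _))))))
  bit∧≤ : ∀ a b → bit a * bit b ≤ bit b
  bit∧≤ true b = ≤-reflexive (+-identityʳ (bit b))
  bit∧≤ false b = z≤n
  covered≤Γ¹ : covered S* ≤ Γ¹size G S*
  covered≤Γ¹ = ≤-trans (∑-mono (λ u → bit∧≤ (marked u) _)) (≤-reflexive (sym (Γ¹size≡∑ G S*)))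

≤ᵇ-true⇒≤ : ∀ {m n} → (m ≤ᵇ n) ≡ true → m ≤ n
≤ᵇ-true⇒≤ {m} {n} eq = ≤ᵇ⇒≤ m n (Equivalence.from T-≡ eq)

<ᵇ-true⇒< : ∀ {m n} → (m <ᵇ n) ≡ true → m < n
<ᵇ-true⇒< {m} {n} eq = <ᵇ⇒< m n (Equivalence.from T-≡ eq)

≤⇒≤ᵇ-true : ∀ {m n} → m ≤ n → (m ≤ᵇ n) ≡ true
≤⇒≤ᵇ-true m≤n = Equivalence.to T-≡ (≤⇒≤ᵇ m≤n)

<⇒<ᵇ-true : ∀ {m n} → m < n → (m <ᵇ n) ≡ true
<⇒<ᵇ-true m<n = Equivalence.to T-≡ (<⇒<ᵇ m<n)

∧-true : ∀ {a b} → (a ∧ b) ≡ true → (a ≡ true) × (b ≡ true)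
∧-true {true} {true} _ = refl , refl

inClass : ℕ → ℕ → Bool
inClass j x = (2 ^ j ≤ᵇ x) ∧ (x <ᵇ 2 ^ suc j)

-- Each dyadic degree class of N is covered, up to a factor 8, by Γ¹ of a
-- single subset: choose every vertex of S with probability 2^-(j+2).
class-covered : ∀ {s m} (G : BipGraph s m) j → ∃[ S ] (count m (λ u → inClass j (degN G u)) ≤ 8 * Γ¹size G S)
class-covered {s} G j = marked-covered G e 8 _ likely
  where
  d e : ℕ
  d = 2 ^ j
  e = 4 * d ∸ 1
  1+e≡4d : suc e ≡ 4 * d
  1+e≡4d = m+[n∸m]≡n (≤-trans (m^n>0 2 j) (m≤n*m d 4))
  likely : ∀ u → inClass j (degN G u) ≡ true → suc e ^ s ≤ 8 * wsum s e (λ S → bit (hits (nbhd G u) S ≡ᵇ 1))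
  likely u inj = degree-class-likely s e d (nbhd G u) 1+e≡4d
    (subst (d ≤_) (degN≡size G u) (≤ᵇ-true⇒≤ (proj₁ (∧-true inj))))
    (subst (_< 2 * d) (degN≡size G u) (<ᵇ-true⇒< (proj₂ (∧-true inj))))

find-class : ∀ L x → 1 ≤ x → x < 2 ^ suc L → ∃[ j ] (j < suc L × inClass j x ≡ true)
find-class zero x 1≤x x<2 = 0 , s≤s z≤n , cong₂ _∧_ (≤⇒≤ᵇ-true 1≤x) (<⇒<ᵇ-true x<2)
find-class (suc L) x 1≤x x<2P with x <? 2 ^ suc L
... | yes x<P with find-class L x 1≤x x<P
...   | j , j≤L , inj = j , m≤n⇒m≤1+n j≤L , inj
find-class (suc L) x 1≤x x<2P | no x≮P = suc L , ≤-refl , cong₂ _∧_ (≤⇒≤ᵇ-true (≮⇒≥ x≮P)) (<⇒<ᵇ-true x<2P)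

classify : ∀ L x → bit (1 ≤ᵇ x) ≤ ∑[ j < suc L ] bit (inClass (toℕ j) x) + bit (2 ^ suc L ≤ᵇ x)
classify L zero = z≤n
classify L (suc x) with suc x <? 2 ^ suc L
... | no x≮P rewrite ≤⇒≤ᵇ-true (≮⇒≥ x≮P) = m≤n+m 1 _
... | yes x<P with find-class L (suc x) (s≤s z≤n) x<P
...   | j , j≤L , inj = ≤-trans (≤-trans (≤-reflexive (cong bit (sym inj'))) (∑-term (λ i → bit (inClass (toℕ i) (suc x))) (fromℕ< j≤L))) (m≤m+n _ _)
  where
  inj' : inClass (toℕ (fromℕ< j≤L)) (suc x) ≡ true
  inj' = trans (cong (λ i → inClass i (suc x)) (toℕ-fromℕ< j≤L)) inj

markov : ∀ {m} (f : Fin m → ℕ) P → P * ∑[ u < m ] bit (P ≤ᵇ f u) ≤ ∑[ u < m ] f u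
markov f P = ≤-trans (≤-reflexive (*-distribˡ-sum P (λ u → bit (P ≤ᵇ f u)))) (∑-mono large≤)
  where
  large≤ : ∀ u → P * bit (P ≤ᵇ f u) ≤ f u
  large≤ u with P ≤ᵇ f u in P≤f
  ... | true = ≤-trans (≤-reflexive (*-identityʳ P)) (≤ᵇ-true⇒≤ P≤f)
  ... | false = ≤-trans (≤-reflexive (*-zeroʳ P)) z≤n

module _ {s m : ℕ} (G : BipGraph s m) where

  active : ℕ
  active = count m (λ u → 1 ≤ᵇ degN G u)

  classSize : (L : ℕ) → Fin (suc L) → ℕ
  classSize L j = count m (λ u → inClass (toℕ j) (degN G u))

  heavy : ℕ → ℕ
  heavy L = count m (λ u → 2 ^ suc L ≤ᵇ degN G u)

  edgesN≡∑ : edgesN G ≡ ∑[ u < m ] degN G u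
  edgesN≡∑ = listSum≡∑ m (degN G)

  active-split : ∀ L → active ≤ ∑[ j < suc L ] classSize L j + heavy L
  active-split L = begin
    active                                                  ≡⟨ count≡∑ m _ ⟩
    ∑[ u < m ] bit (1 ≤ᵇ degN G u)                           ≤⟨ ∑-mono (λ u → classify L (degN G u)) ⟩
    ∑[ u < m ] (∑[ j < suc L ] inj u j + bit (2 ^ suc L ≤ᵇ degN G u))
      ≡⟨ ∑-distrib-+ (λ u → ∑[ j < suc L ] inj u j) _ ⟩
    ∑[ u < m ] ∑[ j < suc L ] inj u j + ∑[ u < m ] bit (2 ^ suc L ≤ᵇ degN G u)
      ≡⟨ cong₂ _+_ (∑-comm inj) (sym (count≡∑ m _)) ⟩
    ∑[ j < suc L ] ∑[ u < m ] inj u j + heavy L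
      ≡⟨ cong (_+ heavy L) (sum-cong-≗ {suc L} (λ j → sym (count≡∑ m (λ u → inClass (toℕ j) (degN G u))))) ⟩
    ∑[ j < suc L ] classSize L j + heavy L                    ∎
    where
    open ≤-Reasoning
    inj : Fin m → Fin (suc L) → ℕ
    inj u j = bit (inClass (toℕ j) (degN G u))

  heavy-few : ∀ L → edgesN G ≤ 2 ^ L * active → 2 * heavy L ≤ active
  heavy-few L E≤ = *-cancelˡ-≤ (2 ^ L) {{m^n≢0 2 L}} (begin
    2 ^ L * (2 * heavy L)   ≡⟨ x*[y*z]≡y*x*z (2 ^ L) 2 (heavy L) ⟩
    2 ^ suc L * heavy L     ≡⟨ cong (2 ^ suc L *_) (count≡∑ m _) ⟩
    2 ^ suc L * ∑[ u < m ] bit (2 ^ suc L ≤ᵇ degN G u) ≤⟨ markov (degN G) (2 ^ suc L) ⟩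
    ∑[ u < m ] degN G u     ≡⟨ sym edgesN≡∑ ⟩
    edgesN G                ≤⟨ E≤ ⟩
    2 ^ L * active          ∎)
    where
    open ≤-Reasoning

  dyadic-covered : ∀ L → 1 ≤ L → edgesN G ≤ 2 ^ L * active → ∃[ S ] (active ≤ 32 * L * Γ¹size G S)
  dyadic-covered L 1≤L E≤ = S , (begin
    active                            ≤⟨ light-half ⟩
    2 * classes                       ≤⟨ *-monoʳ-≤ 2 j*-largest ⟩
    2 * (suc L * classSize L j*)      ≤⟨ *-monoʳ-≤ 2 (*-monoʳ-≤ (suc L) S-covers) ⟩
    2 * ((1 + L) * (8 * Γ¹size G S))  ≡⟨ regroup L (Γ¹size G S) ⟩
    16 * (1 + L) * Γ¹size G S         ≤⟨ *-monoˡ-≤ (Γ¹size G S) (*-monoʳ-≤ 16 (+-monoˡ-≤ L 1≤L)) ⟩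
    16 * (L + L) * Γ¹size G S         ≡⟨ cong (_* Γ¹size G S) (sixteen-double L) ⟩
    32 * L * Γ¹size G S               ∎)
    where
    open ≤-Reasoning
    classes : ℕ
    classes = ∑[ j < suc L ] classSize L j
    light-half : active ≤ 2 * classes
    light-half = +-cancelʳ-≤ active active (2 * classes) (begin
      active + active                  ≡⟨ cong (active +_) (sym (+-identityʳ active)) ⟩
      2 * active                       ≤⟨ *-monoʳ-≤ 2 (active-split L) ⟩
      2 * (classes + heavy L)          ≡⟨ *-distribˡ-+ 2 classes (heavy L) ⟩
      2 * classes + 2 * heavy L        ≤⟨ +-monoʳ-≤ (2 * classes) (heavy-few L E≤) ⟩
      2 * classes + active             ∎)
    j* : Fin (suc L)
    j* = proj₁ (∑-average (classSize L))
    j*-largest : classes ≤ suc L * classSize L j*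
    j*-largest = proj₂ (∑-average (classSize L))
    S : Subset s
    S = proj₁ (class-covered G (toℕ j*))
    S-covers : classSize L j* ≤ 8 * Γ¹size G S
    S-covers = proj₂ (class-covered G (toℕ j*))
    regroup : ∀ L Γ → 2 * ((1 + L) * (8 * Γ)) ≡ 16 * (1 + L) * Γ
    regroup = solve-∀
    sixteen-double : ∀ L → 16 * (L + L) ≡ 32 * L
    sixteen-double = solve-∀

  active≤edges : active ≤ edgesN G
  active≤edges = begin
    active                          ≡⟨ count≡∑ m _ ⟩
    ∑[ u < m ] bit (1 ≤ᵇ degN G u)   ≤⟨ ∑-mono (λ u → bit-positive (degN G u)) ⟩
    ∑[ u < m ] degN G u             ≡⟨ sym edgesN≡∑ ⟩
    edgesN G                        ∎
    where
    open ≤-Reasoning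
    bit-positive : ∀ x → bit (1 ≤ᵇ x) ≤ x
    bit-positive zero = z≤n
    bit-positive (suc x) = s≤s z≤n

dyadic-scale : ∀ E a → 1 ≤ a → a ≤ E → ∃[ L ] (1 ≤ L × E ≤ 2 ^ L * a × 2 ^ L * a ≤ 2 * E)
dyadic-scale E a 1≤a a≤E = search E 1 ≤-refl (*-monoʳ-≤ 2 a≤E) (m≤m+n E _)
  where
  -- double 2^L a until it reaches E; the gap k to E shrinks at each step
  search : ∀ k L → 1 ≤ L → 2 ^ L * a ≤ 2 * E → E ≤ k + 2 ^ L * a →
           ∃[ L ] (1 ≤ L × E ≤ 2 ^ L * a × 2 ^ L * a ≤ 2 * E)
  search k L 1≤L below E≤k+ with E ≤? 2 ^ L * a
  ... | yes E≤ = L , 1≤L , E≤ , below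
  search zero L 1≤L below E≤k+ | no E≰ = ⊥-elim (E≰ E≤k+)
  search (suc k) L 1≤L below E≤k+ | no E≰ =
    search k (suc L) (m≤n⇒m≤1+n 1≤L) (≤-trans (≤-reflexive (*-assoc 2 (2 ^ L) a)) (*-monoʳ-≤ 2 (<⇒≤ (≰⇒> E≰))))
      (≤-trans E≤k+ (≤-trans (≤-reflexive (sym (+-suc k x))) (+-monoʳ-≤ k 1+x≤2x)))
    where
    x : ℕ
    x = 2 ^ L * a
    1+x≤2x : suc x ≤ 2 ^ suc L * a
    1+x≤2x = ≤-trans (+-monoˡ-≤ x (*-mono-≤ (m^n>0 2 L) 1≤a))
               (≤-reflexive (trans (cong (x +_) (sym (+-identityʳ x))) (sym (*-assoc 2 (2 ^ L) a))))

-- The theorem in logarithm-free form: for some L with 2^L ≤ 2δ (2^L |active| ≤ 2|E|)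
-- and some S, the set Γ¹(S) has at least |active| / (32 L) elements.
wireless-bipartite : ∀ {s m} (G : BipGraph s m) →
  ∃[ L ] ∃[ S ] (2 ^ L * active G ≤ 2 * edgesN G × active G ≤ 32 * L * Γ¹size G S)
wireless-bipartite G = by-cases (1 ≤? active G)
  where
  Goal : Set
  Goal = ∃[ L ] ∃[ S ] (2 ^ L * active G ≤ 2 * edgesN G × active G ≤ 32 * L * Γ¹size G S)
  at-scale : ∃[ L ] (1 ≤ L × edgesN G ≤ 2 ^ L * active G × 2 ^ L * active G ≤ 2 * edgesN G) → Goal
  at-scale (L , 1≤L , E≤ , ≤2E) = L , proj₁ covered , ≤2E , proj₂ covered
    where
    covered : ∃[ S ] (active G ≤ 32 * L * Γ¹size G S)
    covered = dyadic-covered G L 1≤L E≤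
  by-cases : Dec (1 ≤ active G) → Goal
  by-cases (yes some-active) = at-scale (dyadic-scale (edgesN G) (active G) some-active (active≤edges G))
  by-cases (no no-active) =
    0 , ∅ , ≤-trans (≤-reflexive (+-identityʳ (active G))) (≤-trans (active≤edges G) (m≤m+n (edgesN G) _))
      , ≮⇒≥ no-active

-- Clearing the logarithm: from 2^L M ≤ C (that is, L ≤ log(C/M)) and
-- t ≤ L x, conclude 2^t M^x ≤ C^x (that is, t ≤ x log(C/M)).
exp-form : ∀ L M C x t → 2 ^ L * M ≤ C → t ≤ L * x → 2 ^ t * M ^ x ≤ C ^ x
exp-form L M C x t 2^LM≤C t≤Lx = begin
  2 ^ t * M ^ x         ≤⟨ *-monoˡ-≤ (M ^ x) (^-monoʳ-≤ 2 t≤Lx) ⟩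
  2 ^ (L * x) * M ^ x   ≡⟨ cong (_* M ^ x) (sym (^-*-assoc 2 L x)) ⟩
  (2 ^ L) ^ x * M ^ x   ≡⟨ sym (^-distrib-* (2 ^ L) M x) ⟩
  (2 ^ L * M) ^ x       ≤⟨ ^-monoˡ-≤ x 2^LM≤C ⟩
  C ^ x                 ∎
  where
  open ≤-Reasoning
  ^-distrib-* : ∀ a b n → (a * b) ^ n ≡ a ^ n * b ^ n
  ^-distrib-* a b zero = refl
  ^-distrib-* a b (suc n) = trans (cong (a * b *_) (^-distrib-* a b n)) ([m*n]*[o*p]≡[m*o]*[n*p] a b (a ^ n) (b ^ n))

β-scaled : ∀ βn βd k B L Γ → βn * k ≤ βd * B → B ≤ 32 * L * Γ → 1 * βn * k ≤ L * (32 * βd * Γ)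
β-scaled βn βd k B L Γ βk≤B B≤ = begin
  1 * βn * k          ≡⟨ cong (_* k) (*-identityˡ βn) ⟩
  βn * k              ≤⟨ βk≤B ⟩
  βd * B              ≤⟨ *-monoʳ-≤ βd B≤ ⟩
  βd * (32 * L * Γ)   ≡⟨ regroup βd L Γ ⟩
  L * (32 * βd * Γ)   ∎
  where
  open ≤-Reasoning
  regroup : ∀ b L Γ → b * (32 * L * Γ) ≡ L * (32 * b * Γ)
  regroup = solve-∀

all-active : ∀ {s m} (G : BipGraph s m) → (∀ u → 1 ≤ degN G u) → active G ≡ m
all-active {m = m} G nonisolated =
  trans (count≡∑ m _) (trans (sum-cong-≗ (λ u → cong bit (≤⇒≤ᵇ-true (nonisolated u)))) (∑-ones m))

bipartite-bound : ∀ {s m} (G : BipGraph s m) βn βd → (∀ u → 1 ≤ degN G u) → βn * s ≤ βd * m →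
  ∃[ S* ] (2 ^ (1 * m) * m ^ (32 * Γ¹size G S*) ≤ (2 * edgesN G) ^ (32 * Γ¹size G S*)
         × 2 ^ (1 * βn * s) * m ^ (32 * βd * Γ¹size G S*) ≤ (2 * edgesN G) ^ (32 * βd * Γ¹size G S*))
bipartite-bound {s} {m} G βn βd nonisolated βs≤m with wireless-bipartite G
... | L , S* , scale , covers rewrite all-active G nonisolated =
  S* , exp-form L m (2 * edgesN G) (32 * Γ) (1 * m) scale N-small
     , exp-form L m (2 * edgesN G) (32 * βd * Γ) (1 * βn * s) scale S-small
  where
  open ≤-Reasoning
  Γ : ℕ
  Γ = Γ¹size G S*
  N-small : 1 * m ≤ L * (32 * Γ)
  N-small = begin
    1 * m           ≡⟨ *-identityˡ m ⟩
    m               ≤⟨ covers ⟩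
    32 * L * Γ      ≡⟨ regroup L Γ ⟩
    L * (32 * Γ)    ∎
    where
    regroup : ∀ L Γ → 32 * L * Γ ≡ L * (32 * Γ)
    regroup = solve-∀
  S-small : 1 * βn * s ≤ L * (32 * βd * Γ)
  S-small = β-scaled βn βd s m L Γ βs≤m covers

∣∣≡∑ : ∀ {n} (X : Subset n) → ∣ X ∣ ≡ ∑[ i < n ] bit (lookup X i)
∣∣≡∑ [] = refl
∣∣≡∑ (true ∷ X) = cong suc (∣∣≡∑ X)
∣∣≡∑ (false ∷ X) = ∣∣≡∑ X

nonempty⇒1≤∣∣ : ∀ {n} (X : Subset n) → Nonempty X → 1 ≤ ∣ X ∣
nonempty⇒1≤∣∣ X (x , x∈X) = subst (1 ≤_) (sym (∣∣≡∑ X))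
  (≤-trans (≤-reflexive (cong bit (sym ([]=⇒lookup x∈X)))) (∑-term (bit ∘ lookup X) x))

module _ {n : ℕ} (G : Graph n) (X : Subset n) where
  open Graph G

  induced : BipGraph n n
  induced = record { adj = λ v u → (lookup X v ∧ adj v u) ∧ not (lookup X u) }

  active-induced : active induced ≡ boundary G X
  active-induced = count-cong n pointwise
    where
    pointwise : ∀ u → (1 ≤ᵇ count n (λ v → (lookup X v ∧ adj v u) ∧ not (lookup X u)))
                    ≡ (not (lookup X u) ∧ (1 ≤ᵇ count n (λ v → lookup X v ∧ adj v u)))
    pointwise u with lookup X u
    ... | true = cong (1 ≤ᵇ_) (count-none n (λ v → ∧-zeroʳ _))
    ... | false = cong (1 ≤ᵇ_) (count-cong n (λ v → ∧-identityʳ _))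

  Γ¹-induced : ∀ S → Γ¹size induced S ≡ Γ¹ G X (X ∩ S)
  Γ¹-induced S = count-cong n pointwise
    where
    reassoc : ∀ s x a → s ∧ ((x ∧ a) ∧ true) ≡ (x ∧ s) ∧ a
    reassoc true true a = ∧-identityʳ a
    reassoc true false a = refl
    reassoc false true a = refl
    reassoc false false a = refl
    pointwise : ∀ u → (count n (λ v → lookup S v ∧ ((lookup X v ∧ adj v u) ∧ not (lookup X u))) ≡ᵇ 1)
                    ≡ (not (lookup X u) ∧ (count n (λ v → lookup (X ∩ S) v ∧ adj v u) ≡ᵇ 1))
    pointwise u with lookup X u
    ... | true = cong (_≡ᵇ 1) (count-none n (λ v → trans (cong (lookup S v ∧_) (∧-zeroʳ _)) (∧-zeroʳ (lookup S v))))
    ... | false = cong (_≡ᵇ 1) (count-cong n (λ v → trans (reassoc (lookup S v) (lookup X v) (adj v u))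
                     (cong (_∧ adj v u) (sym (lookup-zipWith _∧_ v X S)))))

  edges-induced : ∀ Δ → MaxDeg G Δ → edgesN induced ≤ Δ * ∣ X ∣
  edges-induced Δ maxDeg = begin
    edgesN induced                                  ≡⟨ edgesN≡∑ induced ⟩
    ∑[ u < n ] degN induced u                       ≡⟨ sum-cong-≗ {n} (λ u → count≡∑ n (λ v → edge' v u)) ⟩
    ∑[ u < n ] ∑[ v < n ] edge v u                  ≡⟨ ∑-comm {n} {n} (λ u v → edge v u) ⟩
    ∑[ v < n ] ∑[ u < n ] edge v u                  ≤⟨ ∑-mono out-degree ⟩
    ∑[ v < n ] (Δ * bit (lookup X v))               ≡⟨ sym (*-distribˡ-sum Δ (bit ∘ lookup X)) ⟩
    Δ * ∑[ v < n ] bit (lookup X v)                 ≡⟨ cong (Δ *_) (sym (∣∣≡∑ X)) ⟩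
    Δ * ∣ X ∣                                       ∎
    where
    open ≤-Reasoning
    edge' : Fin n → Fin n → Bool
    edge' v u = (lookup X v ∧ adj v u) ∧ not (lookup X u)
    edge : Fin n → Fin n → ℕ
    edge v u = bit (edge' v u)
    edge≤adj : ∀ a b c → bit ((a ∧ b) ∧ c) ≤ bit b
    edge≤adj true true true = ≤-refl
    edge≤adj true true false = z≤n
    edge≤adj true false c = z≤n
    edge≤adj false b c = z≤n
    out-degree : ∀ v → ∑[ u < n ] edge v u ≤ Δ * bit (lookup X v)
    out-degree v with lookup X v
    ... | false = ≤-reflexive (trans (sum-replicate-zero n) (sym (*-zeroʳ Δ)))
    ... | true = ≤-trans (∑-mono (λ u → edge≤adj true (adj v u) _))
                   (≤-trans (≤-reflexive (sym (count≡∑ n (adj v)))) (≤-trans (maxDeg v) (≤-reflexive (sym (*-identityʳ Δ)))))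

expander-bound : ∀ {n} (G : Graph n) (X : Subset n) βn βd Δ → MaxDeg G Δ → Nonempty X →
  βn * ∣ X ∣ ≤ βd * boundary G X →
  ∃[ X' ] (X' ⊆ X × 2 ^ (1 * βn * ∣ X ∣) * βn ^ (32 * βd * Γ¹ G X X') ≤ (2 * Δ * βd) ^ (32 * βd * Γ¹ G X X'))
expander-bound G X βn βd Δ maxDeg X≠∅ expands with wireless-bipartite (induced G X)
... | L , S , scale , covers =
  X ∩ S , (λ x∈X∩S → proj₁ (x∈p∩q⁻ X S x∈X∩S)) ,
  subst (λ γ → 2 ^ (1 * βn * k) * βn ^ (32 * βd * γ) ≤ (2 * Δ * βd) ^ (32 * βd * γ)) (Γ¹-induced G X S)
        (exp-form L βn (2 * Δ * βd) (32 * βd * Γ) (1 * βn * k) scale′ X-small)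
  where
  open ≤-Reasoning
  k B Γ : ℕ
  k = ∣ X ∣
  B = active (induced G X)
  Γ = Γ¹size (induced G X) S
  βk≤B : βn * k ≤ βd * B
  βk≤B = subst (λ b → βn * k ≤ βd * b) (sym (active-induced G X)) expands
  -- 2^L ≤ 2δ ≤ 2Δ|X| / |Γ(X) \ X| ≤ 2Δ/β
  scale′ : 2 ^ L * βn ≤ 2 * Δ * βd
  scale′ = *-cancelˡ-≤ k {{>-nonZero (nonempty⇒1≤∣∣ X X≠∅)}} (begin
    k * (2 ^ L * βn)     ≡⟨ x*[y*z]≡y*[z*x] k (2 ^ L) βn ⟩
    2 ^ L * (βn * k)     ≤⟨ *-monoʳ-≤ (2 ^ L) βk≤B ⟩
    2 ^ L * (βd * B)     ≡⟨ x*[y*z]≡y*[x*z] (2 ^ L) βd B ⟩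
    βd * (2 ^ L * B)     ≤⟨ *-monoʳ-≤ βd scale ⟩
    βd * (2 * edgesN (induced G X)) ≤⟨ *-monoʳ-≤ βd (*-monoʳ-≤ 2 (edges-induced G X Δ maxDeg)) ⟩
    βd * (2 * (Δ * k))   ≡⟨ regroup βd Δ k ⟩
    k * (2 * Δ * βd)     ∎)
    where
    regroup : ∀ b d k → b * (2 * (d * k)) ≡ k * (2 * d * b)
    regroup = solve-∀
  X-small : 1 * βn * k ≤ L * (32 * βd * Γ)
  X-small = β-scaled βn βd k B L Γ βk≤B covers

-- Lemma 4.2 with c = c' = 1/32.  The argument does not need β ≥ 1, Δ ≥ 1 or
-- the degree bound of the bipartite graph; α only enters through the expansion.
lemma4p2 : Σ ℕ λ p → Σ ℕ λ q → Σ ℕ λ p' → Σ ℕ λ q' →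
    (1 ≤ p) × (1 ≤ q) × (1 ≤ p') × (1 ≤ q') ×
    (∀ (βn βd Δ s m : ℕ) (G : BipGraph s m) →
      1 ≤ βd → βd ≤ βn → 1 ≤ Δ →
      βn * s ≤ βd * m → MaxDegBip G Δ → NoIsolated G →
      ∃[ S' ] (2 ^ (p * m) * m ^ (q * Γ¹size G S') ≤ (2 * edgesN G) ^ (q * Γ¹size G S')
              × 2 ^ (p * βn * s) * m ^ (q * βd * Γ¹size G S') ≤ (2 * edgesN G) ^ (q * βd * Γ¹size G S')))
    ×
    (∀ (n : ℕ) (G : Graph n) (αn αd βn βd Δ : ℕ) →
      1 ≤ αd → 1 ≤ βd → βd ≤ βn → 1 ≤ Δ →
      IsExpander G αn αd βn βd → MaxDeg G Δ →
      ∀ (X : Subset n) → Nonempty X → αd * ∣ X ∣ ≤ αn * n →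
      ∃[ X' ] (X' ⊆ X
              × 2 ^ (p' * βn * ∣ X ∣) * βn ^ (q' * βd * Γ¹ G X X') ≤ (2 * Δ * βd) ^ (q' * βd * Γ¹ G X X')))
lemma4p2 = 1 , 32 , 1 , 32 , 1≤1 , 1≤32 , 1≤1 , 1≤32 ,
  (λ βn βd Δ s m G _ _ _ βs≤m _ (_ , N-nonisolated) → bipartite-bound G βn βd N-nonisolated βs≤m) ,
  (λ n G αn αd βn βd Δ _ _ _ _ expander maxDeg X X≠∅ X-small →
     expander-bound G X βn βd Δ maxDeg X≠∅ (expander X X-small))
  where
  1≤1 : 1 ≤ 1
  1≤1 = ≤-refl
  1≤32 : 1 ≤ 32
  1≤32 = s≤s z≤n
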